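{- Let $L$ be a list assignment of an $r$-uniform hypergraph $H$. If $(r-1)|L(X)|\ge |X|$ for every nonempty subset $X\subseteq V(H)$, then $H$ is $L$-colorable.
   Context: Hypergraphs are finite. A list assignment $L$ assigns to each vertex $v$ a set $L(v)$ of colors; $L(X)=\bigcup_{v\in X}L(v)$. $H$ is $L$-colorable if there is a coloring with each vertex colored from its list such that no edge is monochromatic. -}

module Defs where

open import Data.Nat using (ℕ; zero; suc)
open import Data.Bool using (true; false)
open import Data.Fin using (Fin; zero; suc)
open import Data.Fin.Subset using (Subset; _∈_; _∪_; ⊥)
open import Data.List using (List)
open import Data.List.Membership.Propositional renaming (_∈_ to _∈ˡ_)
open import Data.Vec using (_∷_; [])
open import Relation.Binary.PropositionalEquality using (_≡_)
open import Relation.Nullary using (¬_)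
open import Function using (_∘_)
open import Data.Product using (Σ; _×_)

record Hypergraph (n : ℕ) : Set where
  constructor hypergraph
  field
    edges : List (Subset n)
open Hypergraph public

Uniform : {n : ℕ} → ℕ → Hypergraph n → Set
Uniform r H = ∀ e → e ∈ˡ edges H → Data.Fin.Subset.∣ e ∣ ≡ r

ListAssignment : ℕ → ℕ → Set
ListAssignment n k = Fin n → Subset k

unionOver : {n k : ℕ} → ListAssignment n k → Subset n → Subset k
unionOver {zero}  L []            = ⊥
unionOver {suc n} L (true  ∷ X)   = L zero ∪ unionOver (L ∘ suc) X
unionOver {suc n} L (false ∷ X)   = unionOver (L ∘ suc) X

Monochromatic : {n k : ℕ} → (Fin n → Fin k) → Subset n → Set
Monochromatic c e = ∀ u v → u ∈ e → v ∈ e → c u ≡ c v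

LColorable : {n k : ℕ} → Hypergraph n → ListAssignment n k → Set
LColorable {n} {k} H L =
  Σ (Fin n → Fin k) λ c →
    (∀ v → c v ∈ L v) × (∀ e → e ∈ˡ edges H → ¬ Monochromatic c e)

-- Call L c-Hall when |X| ≤ c·|L(X)| for every vertex set X. If a list L(v) holds two colours
-- a ≠ b, deleting a or deleting b from it keeps L c-Hall (Rado): otherwise there are violators
-- X₁, X₂ of the two shrunken assignments L₁, L₂, both containing v, and L(X₁ ∪ X₂) ⊆ L₁(X₁) ∪ L₂(X₂),
-- L((X₁ ∩ X₂) − v) ⊆ L₁(X₁) ∩ L₂(X₂), so the Hall condition for these two sets gives
-- |X₁| + |X₂| − 1 ≤ c·(|L₁(X₁)| + |L₂(X₂)|) ≤ |X₁| + |X₂| − 2. Deleting colours until every list is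
-- a singleton therefore yields a colouring from the lists whose colour classes X satisfy
-- |X| ≤ c·|L(X)| = c; with c = r − 1 no edge of size r is monochromatic.
module Submission where

open import Defs
open import Data.Nat using (ℕ; _≤_; _*_; _∸_)
open import Data.Fin.Subset using (Subset; Nonempty; ∣_∣)

open import Algebra.Definitions.RawMonoid Data.Nat.+-0-rawMonoid using (sum)
open import Data.Empty using (⊥-elim)
open import Data.Fin using (Fin; zero; suc; _≟_)
open import Data.Fin.Properties using (any?)
open import Data.Fin.Subset
  using (_∈_; _∉_; _⊆_; _∪_; _∩_; _─_; _-_; ⁅_⁆; outside; inside)
open import Data.Fin.Subset.Properties
  using ( p─⊥≡p; p─q⊆p; p∩q⊆p; p∩q⊆q; x∉⁅y⁆⇒x≢y; x∈⁅y⁆⇒x≡y; ∣⁅x⁆∣≡1; x∈p∪q⁺; x∈p∪q⁻; x∈p∩q⁺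
        ; x∈p∧x≢y⇒x∈p-y; x∈p⇒∣p-x∣<∣p∣; p⊆q⇒∣p∣≤∣q∣; Empty-unique; ∣⊥∣≡0; anySubset?; nonempty?; _∈?_; ∉⊥)
open import Data.Nat using (zero; suc; _+_; _<_; _<?_; _≤?_; z≤n; s≤s; z<s)
open import Data.Nat.Induction using (<-wellFounded)
open import Data.Nat.Properties
  using ( +-suc; *-zeroʳ; *-identityʳ; *-distribˡ-+; ≤-trans; <-trans; <-irrefl; ≤-pred; n≤0⇒n≡0
        ; 1+n≢0; 1+n≰n; ≰⇒>; ≮⇒≥; ≤⇒≯; +-mono-≤; +-mono-<-≤; +-mono-≤-<; *-monoʳ-≤; module ≤-Reasoning)
open import Data.Product using (Σ; ∃; ∃₂; _×_; _,_; proj₁; proj₂)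
open import Data.Sum as Sum using (_⊎_; inj₁; inj₂)
open import Data.Vec using (_∷_; []; here; there)
open import Data.Vec.Functional using (Vector; updateAt)
open import Data.Vec.Functional.Properties using (updateAt-updates; updateAt-minimal)
open import Function using (_∘_; id)
open import Induction.WellFounded using (Acc; acc)
open import Relation.Binary.PropositionalEquality
  using (_≡_; _≢_; refl; sym; trans; cong; subst; module ≡-Reasoning)
open import Relation.Nullary using (¬_; yes; no; ¬?)
open import Relation.Nullary.Decidable using (decidable-stable)

private variable
  n k : ℕ

∣p∪q∣+∣p∩q∣≡∣p∣+∣q∣ : (p q : Subset n) → ∣ p ∪ q ∣ + ∣ p ∩ q ∣ ≡ ∣ p ∣ + ∣ q ∣
∣p∪q∣+∣p∩q∣≡∣p∣+∣q∣ [] [] = refl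
∣p∪q∣+∣p∩q∣≡∣p∣+∣q∣ (inside ∷ p) (inside ∷ q) = cong suc (begin
  ∣ p ∪ q ∣ + suc ∣ p ∩ q ∣   ≡⟨ +-suc ∣ p ∪ q ∣ ∣ p ∩ q ∣ ⟩
  suc (∣ p ∪ q ∣ + ∣ p ∩ q ∣) ≡⟨ cong suc (∣p∪q∣+∣p∩q∣≡∣p∣+∣q∣ p q) ⟩
  suc (∣ p ∣ + ∣ q ∣)         ≡⟨ +-suc ∣ p ∣ ∣ q ∣ ⟨
  ∣ p ∣ + suc ∣ q ∣           ∎)
  where open ≡-Reasoning
∣p∪q∣+∣p∩q∣≡∣p∣+∣q∣ (inside ∷ p) (outside ∷ q) = cong suc (∣p∪q∣+∣p∩q∣≡∣p∣+∣q∣ p q)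
∣p∪q∣+∣p∩q∣≡∣p∣+∣q∣ (outside ∷ p) (inside ∷ q) =
  trans (cong suc (∣p∪q∣+∣p∩q∣≡∣p∣+∣q∣ p q)) (sym (+-suc ∣ p ∣ ∣ q ∣))
∣p∪q∣+∣p∩q∣≡∣p∣+∣q∣ (outside ∷ p) (outside ∷ q) = ∣p∪q∣+∣p∩q∣≡∣p∣+∣q∣ p q

x∈p⇒∣p∣≡1+∣p-x∣ : {p : Subset n} {x : Fin n} → x ∈ p → ∣ p ∣ ≡ suc ∣ p - x ∣
x∈p⇒∣p∣≡1+∣p-x∣ {p = inside ∷ p}  here        = cong (suc ∘ ∣_∣) (sym (p─⊥≡p p))
x∈p⇒∣p∣≡1+∣p-x∣ {p = inside ∷ p}  (there x∈p) = cong suc (x∈p⇒∣p∣≡1+∣p-x∣ x∈p)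
x∈p⇒∣p∣≡1+∣p-x∣ {p = outside ∷ p} (there x∈p) = x∈p⇒∣p∣≡1+∣p-x∣ x∈p

x∈p─q⇒x∉q : (p q : Subset n) {x : Fin n} → x ∈ p ─ q → x ∉ q
x∈p─q⇒x∉q (inside ∷ p) (outside ∷ q) here        ()
x∈p─q⇒x∉q (_ ∷ p)      (_ ∷ q)       (there x∈) (there x∈q) = x∈p─q⇒x∉q p q x∈ x∈q

x∈p-y⇒x≢y : (p : Subset n) {x y : Fin n} → x ∈ p - y → x ≢ y
x∈p-y⇒x≢y p {y = y} x∈p-y = x∉⁅y⁆⇒x≢y (x∈p─q⇒x∉q p ⁅ y ⁆ x∈p-y)

0<∣p∣⇒Nonempty : (p : Subset n) → 0 < ∣ p ∣ → Nonempty p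
0<∣p∣⇒Nonempty (inside ∷ p)  _      = zero , here
0<∣p∣⇒Nonempty (outside ∷ p) 0<∣p∣ with 0<∣p∣⇒Nonempty p 0<∣p∣
... | x , x∈p = suc x , there x∈p

1<∣p∣⇒distinct : (p : Subset n) → 1 < ∣ p ∣ → ∃₂ λ x y → x ∈ p × y ∈ p × x ≢ y
1<∣p∣⇒distinct p 1<∣p∣ with 0<∣p∣⇒Nonempty p (<-trans z<s 1<∣p∣)
... | x , x∈p with 0<∣p∣⇒Nonempty (p - x) (≤-pred (subst (1 <_) (x∈p⇒∣p∣≡1+∣p-x∣ x∈p) 1<∣p∣))
...   | y , y∈p-x = x , y , x∈p , p─q⊆p p ⁅ x ⁆ y∈p-x , λ x≡y → x∈p-y⇒x≢y p y∈p-x (sym x≡y)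

∣p∣≤1⇒x≡y : {p : Subset n} → ∣ p ∣ ≤ 1 → {x y : Fin n} → x ∈ p → y ∈ p → x ≡ y
∣p∣≤1⇒x≡y {p = p} ∣p∣≤1 {x} {y} x∈p y∈p with x ≟ y
... | yes x≡y = x≡y
... | no  x≢y = ⊥-elim (1+n≢0 (trans (sym (x∈p⇒∣p∣≡1+∣p-x∣ y∈p-x)) ∣p-x∣≡0))
  where
  y∈p-x : y ∈ p - x
  y∈p-x = x∈p∧x≢y⇒x∈p-y y∈p (x≢y ∘ sym)
  ∣p-x∣≡0 : ∣ p - x ∣ ≡ 0
  ∣p-x∣≡0 = n≤0⇒n≡0 (≤-pred (subst (_≤ 1) (x∈p⇒∣p∣≡1+∣p-x∣ x∈p) ∣p∣≤1))

x≡y⇒∣p∣≤1 : (p : Subset n) → (∀ {x y} → x ∈ p → y ∈ p → x ≡ y) → ∣ p ∣ ≤ 1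
x≡y⇒∣p∣≤1 p x≡y with ∣ p ∣ ≤? 1
... | yes ∣p∣≤1 = ∣p∣≤1
... | no  ∣p∣≰1 with 1<∣p∣⇒distinct p (≰⇒> ∣p∣≰1)
...   | x , y , x∈p , y∈p , x≢y = ⊥-elim (x≢y (x≡y x∈p y∈p))

∈-unionOver⁺ : (L : ListAssignment n k) {X : Subset n} {w : Fin n} {a : Fin k} →
               w ∈ X → a ∈ L w → a ∈ unionOver L X
∈-unionOver⁺ L {inside ∷ X}  here        a∈Lw = x∈p∪q⁺ (inj₁ a∈Lw)
∈-unionOver⁺ L {inside ∷ X}  (there w∈X) a∈Lw = x∈p∪q⁺ (inj₂ (∈-unionOver⁺ (L ∘ suc) w∈X a∈Lw))
∈-unionOver⁺ L {outside ∷ X} (there w∈X) a∈Lw = ∈-unionOver⁺ (L ∘ suc) w∈X a∈Lw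

∈-unionOver⁻ : (L : ListAssignment n k) (X : Subset n) {a : Fin k} →
               a ∈ unionOver L X → ∃ λ w → w ∈ X × a ∈ L w
∈-unionOver⁻ {zero}  L []            a∈ = ⊥-elim (∉⊥ a∈)
∈-unionOver⁻ {suc n} L (inside ∷ X)  a∈ with x∈p∪q⁻ (L zero) (unionOver (L ∘ suc) X) a∈
... | inj₁ a∈L0 = zero , here , a∈L0
... | inj₂ a∈LX with ∈-unionOver⁻ (L ∘ suc) X a∈LX
...   | w , w∈X , a∈Lw = suc w , there w∈X , a∈Lw
∈-unionOver⁻ {suc n} L (outside ∷ X) a∈ with ∈-unionOver⁻ (L ∘ suc) X a∈
... | w , w∈X , a∈Lw = suc w , there w∈X , a∈Lw

unionOver-mono : (L L′ : ListAssignment n k) {X Y : Subset n} →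
                 X ⊆ Y → (∀ {w} → w ∈ X → L w ⊆ L′ w) → unionOver L X ⊆ unionOver L′ Y
unionOver-mono L L′ {X} X⊆Y L⊆L′ a∈ with ∈-unionOver⁻ L X a∈
... | w , w∈X , a∈Lw = ∈-unionOver⁺ L′ (X⊆Y w∈X) (L⊆L′ w∈X a∈Lw)

deleteColour : Fin n → Fin k → ListAssignment n k → ListAssignment n k
deleteColour v a L = updateAt L v (_- a)

module _ (L : ListAssignment n k) (v : Fin n) (a : Fin k) where

  deleteColour-at : deleteColour v a L v ≡ L v - a
  deleteColour-at = updateAt-updates v L

  deleteColour-⊆ : ∀ w → deleteColour v a L w ⊆ L w
  deleteColour-⊆ w with w ≟ v
  ... | yes refl = p─q⊆p (L w) ⁅ a ⁆ ∘ subst (_ ∈_) deleteColour-at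
  ... | no  w≢v  = subst (_ ∈_) (updateAt-minimal w v L w≢v)

  deleteColour-⊇ : ∀ {w} → w ≢ v → L w ⊆ deleteColour v a L w
  deleteColour-⊇ {w} w≢v = subst (_ ∈_) (sym (updateAt-minimal w v L w≢v))

unionOver-deleteColour-∉ : (L : ListAssignment n k) {v : Fin n} (a : Fin k) {X Y : Subset n} →
                           v ∉ X → X ⊆ Y → unionOver L X ⊆ unionOver (deleteColour v a L) Y
unionOver-deleteColour-∉ L {v} a {X} v∉X X⊆Y =
  unionOver-mono L _ X⊆Y λ w∈X → deleteColour-⊇ L v a λ w≡v → v∉X (subst (_∈ X) w≡v w∈X)

deleteColour-cover : (L : ListAssignment n k) (v : Fin n) {a b : Fin k} → a ≢ b →
                     L v ⊆ deleteColour v a L v ∪ deleteColour v b L v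
deleteColour-cover L v {a} {b} a≢b {x} x∈Lv with x ≟ a
... | yes refl = x∈p∪q⁺ (inj₂ (subst (x ∈_) (sym (deleteColour-at L v b)) (x∈p∧x≢y⇒x∈p-y x∈Lv a≢b)))
... | no  x≢a  = x∈p∪q⁺ (inj₁ (subst (x ∈_) (sym (deleteColour-at L v a)) (x∈p∧x≢y⇒x∈p-y x∈Lv x≢a)))

unionOver-∪-deleteColour : (L : ListAssignment n k) {v : Fin n} {a b : Fin k} → a ≢ b →
  {X₁ X₂ : Subset n} → v ∈ X₁ → v ∈ X₂ →
  unionOver L (X₁ ∪ X₂) ⊆ unionOver (deleteColour v a L) X₁ ∪ unionOver (deleteColour v b L) X₂
unionOver-∪-deleteColour L {v} {a} {b} a≢b {X₁} {X₂} v∈X₁ v∈X₂ x∈ with ∈-unionOver⁻ L (X₁ ∪ X₂) x∈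
... | w , w∈X₁∪X₂ , x∈Lw with w ≟ v
...   | yes refl = x∈p∪q⁺ (Sum.map (∈-unionOver⁺ (deleteColour v a L) v∈X₁)
                                   (∈-unionOver⁺ (deleteColour v b L) v∈X₂)
                                   (x∈p∪q⁻ _ _ (deleteColour-cover L v a≢b x∈Lw)))
...   | no  w≢v  = x∈p∪q⁺ (Sum.map (λ w∈X₁ → ∈-unionOver⁺ _ w∈X₁ (deleteColour-⊇ L v a w≢v x∈Lw))
                                   (λ w∈X₂ → ∈-unionOver⁺ _ w∈X₂ (deleteColour-⊇ L v b w≢v x∈Lw))
                                   (x∈p∪q⁻ X₁ X₂ w∈X₁∪X₂))

unionOver-∩-deleteColour : (L : ListAssignment n k) (v : Fin n) (a b : Fin k) (X₁ X₂ : Subset n) →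
  unionOver L ((X₁ ∩ X₂) - v) ⊆ unionOver (deleteColour v a L) X₁ ∩ unionOver (deleteColour v b L) X₂
unionOver-∩-deleteColour L v a b X₁ X₂ x∈ =
  x∈p∩q⁺ ( unionOver-deleteColour-∉ L a v∉Y (p∩q⊆p X₁ X₂ ∘ p─q⊆p _ _) x∈
         , unionOver-deleteColour-∉ L b v∉Y (p∩q⊆q X₁ X₂ ∘ p─q⊆p _ _) x∈)
  where
  v∉Y : v ∉ (X₁ ∩ X₂) - v
  v∉Y v∈Y = x∈p-y⇒x≢y (X₁ ∩ X₂) v∈Y refl

Hall : ℕ → ListAssignment n k → Set
Hall {n} c L = ∀ (X : Subset n) → ∣ X ∣ ≤ c * ∣ unionOver L X ∣

Violator : ℕ → ListAssignment n k → Subset n → Set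
Violator c L X = c * ∣ unionOver L X ∣ < ∣ X ∣

Hall-or-violator : ∀ c (L : ListAssignment n k) → Hall c L ⊎ ∃ (Violator c L)
Hall-or-violator c L with anySubset? (λ X → ¬? (∣ X ∣ ≤? c * ∣ unionOver L X ∣))
... | yes (X , X≰) = inj₂ (X , ≰⇒> X≰)
... | no  ∄X≰      = inj₁ λ X → decidable-stable (_ ≤? _) (λ X≰ → ∄X≰ (X , X≰))

Hall-⊆ : ∀ c {L : ListAssignment n k} → Hall c L →
         ∀ {X A} → unionOver L X ⊆ A → ∣ X ∣ ≤ c * ∣ A ∣
Hall-⊆ c hall {X} L[X]⊆A = ≤-trans (hall X) (*-monoʳ-≤ c (p⊆q⇒∣p∣≤∣q∣ L[X]⊆A))

module _ (c : ℕ) (L : ListAssignment n k) (hall : Hall c L) {v : Fin n} {a b : Fin k} (a≢b : a ≢ b) where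

  ¬Violator-deleteColour-both : ∀ {X₁ X₂} →
    Violator c (deleteColour v a L) X₁ → ¬ Violator c (deleteColour v b L) X₂
  ¬Violator-deleteColour-both {X₁} {X₂} viol₁ viol₂ with v ∈? X₁ | v ∈? X₂
  ... | no v∉X₁ | _       = ≤⇒≯ (Hall-⊆ c hall (unionOver-deleteColour-∉ L a v∉X₁ id)) viol₁
  ... | yes _   | no v∉X₂ = ≤⇒≯ (Hall-⊆ c hall (unionOver-deleteColour-∉ L b v∉X₂ id)) viol₂
  ... | yes v∈X₁ | yes v∈X₂ = <-irrefl refl (begin-strict
    suc (c * ∣ A ∣ + c * ∣ B ∣)   ≡⟨ +-suc (c * ∣ A ∣) (c * ∣ B ∣) ⟨
    c * ∣ A ∣ + suc (c * ∣ B ∣)   <⟨ +-mono-≤ viol₁ viol₂ ⟩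
    ∣ X₁ ∣ + ∣ X₂ ∣               ≡⟨ ∣p∪q∣+∣p∩q∣≡∣p∣+∣q∣ X₁ X₂ ⟨
    ∣ X₁ ∪ X₂ ∣ + ∣ X₁ ∩ X₂ ∣      ≡⟨ cong (∣ X₁ ∪ X₂ ∣ +_) (x∈p⇒∣p∣≡1+∣p-x∣ (x∈p∩q⁺ (v∈X₁ , v∈X₂))) ⟩
    ∣ X₁ ∪ X₂ ∣ + suc ∣ Y ∣        ≤⟨ +-mono-≤ (Hall-⊆ c hall (unionOver-∪-deleteColour L a≢b v∈X₁ v∈X₂))
                                             (s≤s (Hall-⊆ c hall (unionOver-∩-deleteColour L v a b X₁ X₂))) ⟩
    c * ∣ A ∪ B ∣ + suc (c * ∣ A ∩ B ∣) ≡⟨ +-suc (c * ∣ A ∪ B ∣) (c * ∣ A ∩ B ∣) ⟩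
    suc (c * ∣ A ∪ B ∣ + c * ∣ A ∩ B ∣) ≡⟨ cong suc (*-distribˡ-+ c ∣ A ∪ B ∣ ∣ A ∩ B ∣) ⟨
    suc (c * (∣ A ∪ B ∣ + ∣ A ∩ B ∣))   ≡⟨ cong (λ m → suc (c * m)) (∣p∪q∣+∣p∩q∣≡∣p∣+∣q∣ A B) ⟩
    suc (c * (∣ A ∣ + ∣ B ∣))           ≡⟨ cong suc (*-distribˡ-+ c ∣ A ∣ ∣ B ∣) ⟩
    suc (c * ∣ A ∣ + c * ∣ B ∣)         ∎)
    where
    open ≤-Reasoning
    A = unionOver (deleteColour v a L) X₁
    B = unionOver (deleteColour v b L) X₂
    Y = (X₁ ∩ X₂) - v

  Hall-deleteColour : Hall c (deleteColour v a L) ⊎ Hall c (deleteColour v b L)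
  Hall-deleteColour
    with Hall-or-violator c (deleteColour v a L) | Hall-or-violator c (deleteColour v b L)
  ... | inj₁ hall₁       | _                = inj₁ hall₁
  ... | inj₂ _           | inj₁ hall₂       = inj₂ hall₂
  ... | inj₂ (_ , viol₁) | inj₂ (_ , viol₂) = ⊥-elim (¬Violator-deleteColour-both viol₁ viol₂)

sum-mono-≤ : {xs ys : Vector ℕ n} → (∀ i → xs i ≤ ys i) → sum xs ≤ sum ys
sum-mono-≤ {zero}  _     = z≤n
sum-mono-≤ {suc n} xs≤ys = +-mono-≤ (xs≤ys zero) (sum-mono-≤ (xs≤ys ∘ suc))

sum-mono-< : {xs ys : Vector ℕ n} → (∀ i → xs i ≤ ys i) → ∀ j → xs j < ys j → sum xs < sum ys
sum-mono-< xs≤ys zero    xs0<ys0 = +-mono-<-≤ xs0<ys0 (sum-mono-≤ (xs≤ys ∘ suc))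
sum-mono-< xs≤ys (suc j) xsj<ysj = +-mono-≤-< (xs≤ys zero) (sum-mono-< (xs≤ys ∘ suc) j xsj<ysj)

size : ListAssignment n k → ℕ
size L = sum (∣_∣ ∘ L)

size-deleteColour : (L : ListAssignment n k) {v : Fin n} {a : Fin k} → a ∈ L v →
                    size (deleteColour v a L) < size L
size-deleteColour L {v} {a} a∈Lv =
  sum-mono-< (λ w → p⊆q⇒∣p∣≤∣q∣ (deleteColour-⊆ L v a w)) v
    (subst (λ p → ∣ p ∣ < ∣ L v ∣) (sym (deleteColour-at L v a)) (x∈p⇒∣p-x∣<∣p∣ a∈Lv))

BoundedChoice : ℕ → ListAssignment n k → Set
BoundedChoice {n} {k} c L =
  Σ (Fin n → Fin k) λ f → (∀ v → f v ∈ L v) × (∀ X → Monochromatic f X → ∣ X ∣ ≤ c)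

BoundedChoice-⊆ : ∀ {c} {L L′ : ListAssignment n k} → (∀ v → L′ v ⊆ L v) →
                  BoundedChoice c L′ → BoundedChoice c L
BoundedChoice-⊆ L′⊆L (f , f∈L′ , bounded) = f , (λ v → L′⊆L v (f∈L′ v)) , bounded

0<m*n⇒0<n : ∀ m {n} → 0 < m * n → 0 < n
0<m*n⇒0<n m {zero}  0<m*0 = ⊥-elim (<-irrefl (sym (*-zeroʳ m)) 0<m*0)
0<m*n⇒0<n m {suc n} _     = z<s

Hall⇒Nonempty : ∀ c (L : ListAssignment n k) → Hall c L → ∀ v → Nonempty (L v)
Hall⇒Nonempty c L hall v
  with 0<∣p∣⇒Nonempty _ (0<m*n⇒0<n c (subst (_≤ c * ∣ unionOver L ⁅ v ⁆ ∣) (∣⁅x⁆∣≡1 v) (hall ⁅ v ⁆)))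
... | x , x∈L[v] with ∈-unionOver⁻ L ⁅ v ⁆ x∈L[v]
...   | w , w∈⁅v⁆ , x∈Lw = x , subst (λ u → x ∈ L u) (x∈⁅y⁆⇒x≡y v w∈⁅v⁆) x∈Lw

Hall⇒BoundedChoice-≤1 : ∀ c (L : ListAssignment n k) → Hall c L → (∀ v → ∣ L v ∣ ≤ 1) →
                        BoundedChoice c L
Hall⇒BoundedChoice-≤1 {n} {k} c L hall ∣L∣≤1 = f , f∈L , bounded
  where
  f : Fin n → Fin k
  f v = proj₁ (Hall⇒Nonempty c L hall v)

  f∈L : ∀ v → f v ∈ L v
  f∈L v = proj₂ (Hall⇒Nonempty c L hall v)

  bounded : ∀ X → Monochromatic f X → ∣ X ∣ ≤ c
  bounded X mono = begin
    ∣ X ∣                  ≤⟨ hall X ⟩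
    c * ∣ unionOver L X ∣  ≤⟨ *-monoʳ-≤ c (x≡y⇒∣p∣≤1 (unionOver L X) sameColour) ⟩
    c * 1                  ≡⟨ *-identityʳ c ⟩
    c                      ∎
    where
    open ≤-Reasoning
    sameColour : ∀ {x y} → x ∈ unionOver L X → y ∈ unionOver L X → x ≡ y
    sameColour x∈ y∈ with ∈-unionOver⁻ L X x∈ | ∈-unionOver⁻ L X y∈
    ... | u , u∈X , x∈Lu | w , w∈X , y∈Lw =
      trans (∣p∣≤1⇒x≡y (∣L∣≤1 u) x∈Lu (f∈L u))
            (trans (mono u w u∈X w∈X) (∣p∣≤1⇒x≡y (∣L∣≤1 w) (f∈L w) y∈Lw))

Hall⇒BoundedChoice : ∀ c (L : ListAssignment n k) → Hall c L → BoundedChoice c L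
Hall⇒BoundedChoice c L = go L (<-wellFounded (size L))
  where
  go : ∀ L → Acc _<_ (size L) → Hall c L → BoundedChoice c L
  go L (acc smaller) hall with any? (λ v → 1 <? ∣ L v ∣)
  ... | no  ∄ = Hall⇒BoundedChoice-≤1 c L hall (λ v → ≮⇒≥ (∄ ∘ (v ,_)))
  ... | yes (v , 1<∣Lv∣) with 1<∣p∣⇒distinct (L v) 1<∣Lv∣
  ...   | a , b , a∈Lv , b∈Lv , a≢b with Hall-deleteColour c L hall {v} a≢b
  ...     | inj₁ hall′ = BoundedChoice-⊆ (deleteColour-⊆ L v a)
                           (go _ (smaller (size-deleteColour L a∈Lv)) hall′)
  ...     | inj₂ hall′ = BoundedChoice-⊆ (deleteColour-⊆ L v b)
                           (go _ (smaller (size-deleteColour L b∈Lv)) hall′)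

Hall-fromNonempty : ∀ c (L : ListAssignment n k) →
  (∀ X → Nonempty X → ∣ X ∣ ≤ c * ∣ unionOver L X ∣) → Hall c L
Hall-fromNonempty {n} c L hallₙₑ X with nonempty? X
... | yes X≠∅ = hallₙₑ X X≠∅
... | no  X=∅ = subst (_≤ c * ∣ unionOver L X ∣)
                    (sym (trans (cong ∣_∣ (Empty-unique X=∅)) (∣⊥∣≡0 n))) z≤n

lemma4p2 : (n k r : ℕ) → 1 ≤ r → (H : Hypergraph n) → Uniform r H →
    (L : ListAssignment n k) →
    (∀ (X : Subset n) → Nonempty X → ∣ X ∣ ≤ (r ∸ 1) * ∣ unionOver L X ∣) →
    LColorable H L
lemma4p2 n k (suc r) _ H uniform L hallₙₑ
  with Hall⇒BoundedChoice r L (Hall-fromNonempty r L hallₙₑ)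
... | f , f∈L , bounded =
  f , f∈L , λ e e∈H mono → 1+n≰n (subst (_≤ r) (uniform e e∈H) (bounded e mono))
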